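{- For every positive integer $k$, \[ \frac1{2^k} \sum_{j=0}^k \binom{k}{j} c_k(j) = \sum_{d\mid k} \mu(k/d) \sum_{\ell=1}^d (-1)^{\ell k/d} \cos^k (\ell\pi/d). \]
   Context: For $k\in\mathbb{N}$ and $j\in\mathbb{Z}$, $c_k(j)=\sum_{1\le m\le k,\ \gcd(m,k)=1}\exp(2\pi i m j/k)$ is the Ramanujan sum (so in particular $c_k(0)=\varphi(k)$). $\mu$ is the Möbius function. -}

module Defs where

open import Level using (Level)
open import Data.Nat using (ℕ; zero; suc; _≤?_; _/_) renaming (_*_ to _*ℕ_)
open import Data.Nat.Divisibility using (_∣?_)
open import Data.Nat.Coprimality using (coprime?)
open import Data.Nat.Primality using (prime?)
open import Data.Integer using (ℤ; +_; -[1+_]; -1ℤ) renaming (_^_ to _^ℤ_)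
open import Data.List using (List; []; _∷_; upTo; map; filter; length; foldr)
open import Data.List.Relation.Unary.Any using (any?)
open import Relation.Nullary using (yes; no)
open import Relation.Nullary.Decidable using (_×-dec_)
open import Algebra.Bundles using (CommutativeRing)
import Algebra.Bundles

range1 : ℕ → List ℕ
range1 n = map suc (upTo n)

range0 : ℕ → List ℕ
range0 n = upTo (suc n)

ω : ℕ → ℕ
ω n = length (filter (λ p → prime? p ×-dec (p ∣? n)) (range1 n))

μ : ℕ → ℤ
μ n with any? (λ p → (2 ≤? p) ×-dec ((p *ℕ p) ∣? n)) (range0 n)
... | yes _ = + 0
... | no  _ = -1ℤ ^ℤ ω n

module InRing {c ℓ : Level} (R : CommutativeRing c ℓ) where
  open CommutativeRing R
  open import Algebra.Definitions.RawSemiring (Algebra.Bundles.Semiring.rawSemiring semiring) public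
    using (_^_) renaming (_×_ to _·ℕ_)

  Σ : List ℕ → (ℕ → Carrier) → Carrier
  Σ xs f = foldr (λ x acc → f x + acc) 0# xs

  fromℤ : ℤ → Carrier
  fromℤ (+ n)    = n ·ℕ 1#
  fromℤ -[1+ n ] = - (suc n ·ℕ 1#)

  Σdiv : ℕ → (ℕ → ℕ → Carrier) → Carrier
  Σdiv k f = Σ (upTo k) (λ e → g e)
    where
    g : ℕ → Carrier
    g e with suc e ∣? k
    ... | yes _ = f (suc e) (k / suc e)
    ... | no  _ = 0#

  -- Ramanujan sum c_k(j), where ζ plays the role of e^{iπ/k},
  -- so exp(2πi m j / k) = ζ^(2 m j).
  ramanujan : Carrier → ℕ → ℕ → Carrier
  ramanujan ζ k j = Σ (filter (λ m → coprime? m k) (range1 k)) (λ m → ζ ^ (2 *ℕ m *ℕ j))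

-- With ζ standing for e^{iπ/k}, the binomial theorem turns the left-hand side into
-- 2^{-k} Σ_{m ≤ k, (m,k) = 1} G m, where G m = (1 + ζ^{2m})^k.  Since ζ is a primitive 2k-th root
-- of unity in a domain, ζ^k = −1, so (−1)^b ((ζ^b + ζ^{2k−b})/2)^k = 2^{-k} G b and the right-hand
-- side is 2^{-k} Σ_{d ∣ k} μ(k/d) Σ_{l ≤ d} G(l k/d).  The inner sum runs over the multiples of k/d
-- up to k; exchanging the sums, the coefficient of G m becomes Σ_{q ∣ gcd(m,k)} μ q, which is 1 if
-- (m, k) = 1 and 0 otherwise.  For that last identity, Σ_{d ∣ n} μ d = [n = 1], the divisors of
-- n = N p (p prime) are split by whether p divides them, using μ(l p) = −μ l if p ∤ l and 0 otherwise.

module Submission where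

open import Defs
open import Level using (Level)
open import Algebra.Bundles using (CommutativeRing)
open import Data.Empty using (⊥; ⊥-elim)
open import Data.Fin using (Fin; toℕ)
open import Data.Fin.Properties using (toℕ<n)
open import Data.Integer using (+_; -[1+_]; -1ℤ) renaming (-_ to -ℤ_; _+_ to _+ℤ_; _^_ to _^ℤ_)
import Data.Integer.Properties as ℤₚ
open import Data.List using (List; []; _∷_; map; applyUpTo; upTo; filter; length)
open import Data.List.Membership.Propositional using (lose)
open import Data.List.Membership.Propositional.Properties using (∈-upTo⁺)
open import Data.List.Relation.Unary.Any using (Any; any?; satisfied)
open import Data.Nat
  using (ℕ; zero; suc; _∸_; _<_; _≤_; z≤n; s≤s; _≤?_; _/_; NonZero; >-nonZero; >-nonZero⁻¹;
         ≢-nonZero; ≢-nonZero⁻¹; n>1⇒nonTrivial; nonTrivial⇒n>1)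
  renaming (_*_ to _*ℕ_; _+_ to _+ℕ_)
import Data.Nat.Properties as ℕₚ
open import Data.Nat.Properties using (_≟_)
open import Data.Nat.Combinatorics using (_C_)
open import Data.Nat.Coprimality using (Coprime; coprime?; coprime-divisor; gcd≡1⇒coprime; coprime⇒gcd≡1)
open import Data.Nat.Divisibility
open import Data.Nat.DivMod using (m*n/n≡m; m/n*n≡m)
open import Data.Nat.GCD using (gcd; gcd[m,n]∣m; gcd[m,n]∣n; gcd-greatest; gcd[m,n]≢0)
open import Data.Nat.Induction using (<-rec)
open import Data.Nat.Primality
open import Data.Product using (_×_; _,_; ∃-syntax)
open import Data.Sum using (_⊎_; inj₁; inj₂; [_,_]′)
import Data.Sum as Sum
open import Function using (id; _∘_)
open import Relation.Nullary using (Dec; yes; no; ¬_)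
open import Relation.Nullary.Decidable using (_×-dec_; ¬?)
open import Relation.Unary using (Decidable)
open import Relation.Binary.PropositionalEquality as ≡ using (_≡_; _≢_)

-- Division made total, so that it can be applied to a λ-bound divisor (k ÷ 0 = 0).
infixl 7 _÷_
_÷_ : ℕ → ℕ → ℕ
k ÷ zero  = 0
k ÷ suc d = k / suc d

÷-*-cancel : ∀ {d k} → d ∣ k → (k ÷ d) *ℕ d ≡ k
÷-*-cancel {zero}  0∣k = ≡.sym (0∣⇒≡0 0∣k)
÷-*-cancel {suc d} d∣k = m/n*n≡m d∣k

*-÷-cancel : ∀ {x d k} → x *ℕ suc d ≡ k → x ≡ k ÷ suc d
*-÷-cancel {x} {d} ≡.refl = ≡.sym (m*n/n≡m x (suc d))

÷-∣ : ∀ {d k} → d ∣ k → k ÷ d ∣ k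
÷-∣ {d} {k} d∣k = divides d (≡.sym (≡.trans (ℕₚ.*-comm d (k ÷ d)) (÷-*-cancel d∣k)))

÷-positive : ∀ {d k} → .{{NonZero k}} → d ∣ k → 1 ≤ k ÷ d
÷-positive {d} {k} d∣k with k ÷ d | ÷-*-cancel d∣k
... | zero  | 0≡k = ⊥-elim (≢-nonZero⁻¹ k (≡.sym 0≡k))
... | suc _ | _   = s≤s z≤n

HasPrimeFactor : ℕ → Set
HasPrimeFactor n = ∃[ p ] Prime p × p ∣ n

prime-factor : ∀ n → 2 ≤ n → HasPrimeFactor n
prime-factor = <-rec _ λ n rec 2≤n → factor n rec 2≤n (prime? n)
  where
  factor : ∀ n → (∀ {m} → m < n → 2 ≤ m → HasPrimeFactor m) → 2 ≤ n → Dec (Prime n) → HasPrimeFactor n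
  factor n rec 2≤n (yes n-prime) = n , n-prime , ∣-refl
  factor n rec 2≤n (no ¬n-prime) with ¬prime⇒composite {{n>1⇒nonTrivial 2≤n}} ¬n-prime
  ... | composite {d} d<n d∣n with rec d<n (nonTrivial⇒n>1 d)
  ...   | p , p-prime , p∣d = p , p-prime , ∣-trans p∣d d∣n

prime∣prime : ∀ {r p} → Prime r → Prime p → r ∣ p → r ≡ p
prime∣prime r-prime p-prime r∣p with prime⇒irreducible p-prime r∣p
... | inj₁ ≡.refl = ⊥-elim (¬prime[1] r-prime)
... | inj₂ r≡p    = r≡p

prime∤⇒coprime : ∀ {p m} → Prime p → ¬ p ∣ m → Coprime m p
prime∤⇒coprime p-prime p∤m (i∣m , i∣p) with prime⇒irreducible p-prime i∣p
... | inj₁ i≡1    = i≡1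
... | inj₂ ≡.refl = ⊥-elim (p∤m i∣m)

HasSquareFactor : ℕ → Set
HasSquareFactor n = ∃[ q ] 2 ≤ q × q *ℕ q ∣ n

square-factor-below : ∀ {n} → .{{NonZero n}} → HasSquareFactor n →
                      Any (λ q → 2 ≤ q × q *ℕ q ∣ n) (range0 n)
square-factor-below {n} (q , 2≤q , q²∣n) = lose (∈-upTo⁺ (s≤s q≤n)) (2≤q , q²∣n)
  where
  q≤n : q ≤ n
  q≤n = ℕₚ.≤-trans (ℕₚ.m≤m*n q q {{>-nonZero (ℕₚ.<⇒≤ 2≤q)}}) (∣⇒≤ q²∣n)

μ-squareful : ∀ {n} → .{{NonZero n}} → HasSquareFactor n → μ n ≡ + 0
μ-squareful {n} sq with any? (λ q → (2 ≤? q) ×-dec ((q *ℕ q) ∣? n)) (range0 n)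
... | yes _    = ≡.refl
... | no none  = ⊥-elim (none (square-factor-below sq))

μ-squarefree : ∀ {n} → ¬ HasSquareFactor n → μ n ≡ -1ℤ ^ℤ ω n
μ-squarefree {n} ¬sq with any? (λ q → (2 ≤? q) ×-dec ((q *ℕ q) ∣? n)) (range0 n)
... | yes some = ⊥-elim (¬sq (satisfied some))
... | no _     = ≡.refl

squarefree-prime-* : ∀ {p e} → Prime p → ¬ p ∣ e → ¬ HasSquareFactor e → ¬ HasSquareFactor (p *ℕ e)
squarefree-prime-* {p} {e} p-prime p∤e ¬sq (q , 2≤q , q²∣pe) with p ∣? q *ℕ q
... | yes p∣q² = p∤e (*-cancelˡ-∣ p {{prime⇒nonZero p-prime}} (∣-trans (*-pres-∣ p∣q p∣q) q²∣pe))
  where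
  p∣q : p ∣ q
  p∣q = [ id , id ]′ (euclidsLemma q q p-prime p∣q²)
... | no p∤q²  = ¬sq (q , 2≤q , coprime-divisor (prime∤⇒coprime p-prime p∤q²) q²∣pe)

module Sums {c ℓ : Level} (R : CommutativeRing c ℓ) where

  open CommutativeRing R hiding (zero)
  open InRing R
  open import Algebra.Properties.Ring ring using (-0#≈0#; -1*x≈-x)
  open import Algebra.Properties.Semiring.Sum semiring
    using (sum; sum-cong-≋; sum-replicate-zero; ∑-distrib-+; ∑-comm; *-distribˡ-sum)
  open import Relation.Binary.Reasoning.Setoid setoid

  private
    variable
      a b : Level
      A B C : Set a

  -- Opaque, so that unification compares summands instead of unfolding into a sum over Fin n.
  opaque
    sumTo : ℕ → (ℕ → Carrier) → Carrier
    sumTo n f = sum {n} (λ i → f (suc (toℕ i)))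

  infixr 8 [_]·_
  [_]·_ : Dec A → Carrier → Carrier
  [ yes _ ]· x = x
  [ no _  ]· x = 0#

  Σ-cong : ∀ xs {f g : ℕ → Carrier} → (∀ x → f x ≈ g x) → Σ xs f ≈ Σ xs g
  Σ-cong []       f≈g = refl
  Σ-cong (x ∷ xs) f≈g = +-cong (f≈g x) (Σ-cong xs f≈g)

  Σ-map : ∀ (g : ℕ → ℕ) xs f → Σ (map g xs) f ≡ Σ xs (f ∘ g)
  Σ-map g []       f = ≡.refl
  Σ-map g (x ∷ xs) f = ≡.cong (_+_ (f (g x))) (Σ-map g xs f)

  Σ-applyUpTo : ∀ (g : ℕ → ℕ) n f → Σ (applyUpTo g n) f ≡ sum {n} (λ i → f (g (toℕ i)))
  Σ-applyUpTo g zero    f = ≡.refl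
  Σ-applyUpTo g (suc n) f = ≡.cong (_+_ (f (g 0))) (Σ-applyUpTo (g ∘ suc) n f)

  Σ-filter : ∀ {P : ℕ → Set a} (P? : Decidable P) xs f → Σ (filter P? xs) f ≈ Σ xs (λ x → [ P? x ]· f x)
  Σ-filter P? []       f = refl
  Σ-filter P? (x ∷ xs) f with P? x
  ... | yes _ = +-congˡ (Σ-filter P? xs f)
  ... | no  _ = trans (Σ-filter P? xs f) (sym (+-identityˡ _))

  []·-yes : (D : Dec A) → A → ∀ x → [ D ]· x ≈ x
  []·-yes (yes _) _ x = refl
  []·-yes (no ¬a) a x = ⊥-elim (¬a a)

  []·-no : (D : Dec A) → ¬ A → ∀ x → [ D ]· x ≈ 0#
  []·-no (yes a) ¬a x = ⊥-elim (¬a a)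
  []·-no (no _)  _  x = refl

  []·-cong : (D : Dec A) {x y : Carrier} → (A → x ≈ y) → [ D ]· x ≈ [ D ]· y
  []·-cong (yes a) x≈y = x≈y a
  []·-cong (no _)  _   = refl

  []·-⇔ : (A → B) → (B → A) → (D : Dec A) (E : Dec B) → ∀ x → [ D ]· x ≈ [ E ]· x
  []·-⇔ to from D (yes b) x = []·-yes D (from b) x
  []·-⇔ to from D (no ¬b) x = []·-no D (¬b ∘ to) x

  []·-*ˡ : (D : Dec A) → ∀ x y → [ D ]· (x * y) ≈ x * [ D ]· y
  []·-*ˡ (yes _) x y = refl
  []·-*ˡ (no _)  x y = sym (zeroʳ x)

  []·-*ʳ : (D : Dec A) → ∀ x y → [ D ]· (x * y) ≈ [ D ]· x * y
  []·-*ʳ (yes _) x y = refl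
  []·-*ʳ (no _)  x y = sym (zeroˡ y)

  []·-neg : (D : Dec A) → ∀ x → [ D ]· (- x) ≈ - [ D ]· x
  []·-neg (yes _) x = refl
  []·-neg (no _)  x = sym -0#≈0#

  []·-[]· : (D : Dec A) (E : Dec B) → ∀ x → [ D ]· [ E ]· x ≈ [ D ×-dec E ]· x
  []·-[]· (yes _) (yes _) x = refl
  []·-[]· (yes _) (no _)  x = refl
  []·-[]· (no _)  _       x = refl

  []·-¬ : (D : Dec A) → ∀ x → x ≈ [ D ]· x + [ ¬? D ]· x
  []·-¬ (yes _) x = sym (+-identityʳ x)
  []·-¬ (no _)  x = sym (+-identityˡ x)

  []·-⊎ : (A → B ⊎ C) → (B → A) → (C → A) → (B → C → ⊥) →
          (D : Dec A) (E : Dec B) (F : Dec C) → ∀ x → [ D ]· x ≈ [ E ]· x + [ F ]· x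
  []·-⊎ split B⇒A C⇒A disjoint D (yes b) (yes c) x = ⊥-elim (disjoint b c)
  []·-⊎ split B⇒A C⇒A disjoint D (yes b) (no _)  x = trans ([]·-yes D (B⇒A b) x) (sym (+-identityʳ x))
  []·-⊎ split B⇒A C⇒A disjoint D (no _)  (yes c) x = trans ([]·-yes D (C⇒A c) x) (sym (+-identityˡ x))
  []·-⊎ split B⇒A C⇒A disjoint D (no ¬b) (no ¬c) x =
    trans ([]·-no D ([ ¬b , ¬c ]′ ∘ split) x) (sym (+-identityˡ 0#))

  []·-sum : (D : Dec A) → ∀ n (t : Fin n → Carrier) → [ D ]· sum t ≈ sum (λ i → [ D ]· t i)
  []·-sum (yes _) n t = refl
  []·-sum (no _)  n t = sym (sum-replicate-zero n)

  -- Sums over 1, …, n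

  opaque
    unfolding sumTo

    sumTo-zero : ∀ f → sumTo zero f ≈ 0#
    sumTo-zero f = refl

    sumTo-suc : ∀ n f → sumTo (suc n) f ≈ f 1 + sumTo n (f ∘ suc)
    sumTo-suc n f = refl

    sumTo-1 : ∀ f → sumTo 1 f ≈ f 1
    sumTo-1 f = +-identityʳ (f 1)

    Σ-upTo : ∀ n f → Σ (upTo n) (f ∘ suc) ≡ sumTo n f
    Σ-upTo n f = Σ-applyUpTo id n (f ∘ suc)

    sumTo-cong : ∀ n {f g : ℕ → Carrier} → (∀ x → 1 ≤ x → x ≤ n → f x ≈ g x) → sumTo n f ≈ sumTo n g
    sumTo-cong n f≈g = sum-cong-≋ {n} (λ i → f≈g (suc (toℕ i)) (s≤s z≤n) (toℕ<n i))

    sumTo-vanish : ∀ n {f : ℕ → Carrier} → (∀ x → 1 ≤ x → x ≤ n → f x ≈ 0#) → sumTo n f ≈ 0#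
    sumTo-vanish n f≈0 = trans (sumTo-cong n f≈0) (sum-replicate-zero n)

    sumTo-+ : ∀ n f g → sumTo n (λ x → f x + g x) ≈ sumTo n f + sumTo n g
    sumTo-+ n f g = ∑-distrib-+ {n} (λ i → f (suc (toℕ i))) (λ i → g (suc (toℕ i)))

    sumTo-*ˡ : ∀ n a f → sumTo n (λ x → a * f x) ≈ a * sumTo n f
    sumTo-*ˡ n a f = sym (*-distribˡ-sum {n} a (λ i → f (suc (toℕ i))))

    sumTo-comm : ∀ m n (F : ℕ → ℕ → Carrier) →
                 sumTo m (λ x → sumTo n (F x)) ≈ sumTo n (λ y → sumTo m (λ x → F x y))
    sumTo-comm m n F = ∑-comm {m} {n} (λ i j → F (suc (toℕ i)) (suc (toℕ j)))

    sum-sumTo-comm : ∀ m n (F : Fin m → ℕ → Carrier) →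
                     sum (λ i → sumTo n (F i)) ≈ sumTo n (λ y → sum (λ i → F i y))
    sum-sumTo-comm m n F = ∑-comm {m} {n} (λ i j → F i (suc (toℕ j)))

    []·-sumTo : (D : Dec A) → ∀ n f → [ D ]· sumTo n f ≈ sumTo n (λ x → [ D ]· f x)
    []·-sumTo D n f = []·-sum D n _

  Σ-range1 : ∀ n f → Σ (range1 n) f ≡ sumTo n f
  Σ-range1 n f = ≡.trans (Σ-map suc (upTo n) f) (Σ-upTo n f)

  sumTo-neg : ∀ n f → sumTo n (λ x → - f x) ≈ - sumTo n f
  sumTo-neg n f = begin
    sumTo n (λ x → - f x)       ≈⟨ sumTo-cong n (λ x _ _ → sym (-1*x≈-x (f x))) ⟩
    sumTo n (λ x → - 1# * f x)  ≈⟨ sumTo-*ˡ n (- 1#) f ⟩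
    - 1# * sumTo n f            ≈⟨ -1*x≈-x _ ⟩
    - sumTo n f                 ∎

  sumTo-split : ∀ m b f → sumTo (m +ℕ b) f ≈ sumTo m f + sumTo b (λ x → f (m +ℕ x))
  sumTo-split zero    b f = trans (sym (+-identityˡ _)) (+-congʳ (sym (sumTo-zero f)))
  sumTo-split (suc m) b f = begin
    sumTo (suc m +ℕ b) f                                         ≈⟨ sumTo-suc (m +ℕ b) f ⟩
    f 1 + sumTo (m +ℕ b) (f ∘ suc)                               ≈⟨ +-congˡ (sumTo-split m b (f ∘ suc)) ⟩
    f 1 + (sumTo m (f ∘ suc) + sumTo b (λ x → f (suc m +ℕ x)))   ≈⟨ sym (+-assoc _ _ _) ⟩
    (f 1 + sumTo m (f ∘ suc)) + sumTo b (λ x → f (suc m +ℕ x))   ≈⟨ +-congʳ (sym (sumTo-suc m f)) ⟩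
    sumTo (suc m) f + sumTo b (λ x → f (suc m +ℕ x))             ∎

  sumTo-shrink : ∀ {m n f} → m ≤ n → (∀ x → m < x → x ≤ n → f x ≈ 0#) → sumTo n f ≈ sumTo m f
  sumTo-shrink {n = n} {f} z≤n f≈0 = trans (sumTo-vanish n f≈0) (sym (sumTo-zero f))
  sumTo-shrink {suc m} {suc n} {f} (s≤s m≤n) f≈0 = begin
    sumTo (suc n) f          ≈⟨ sumTo-suc n f ⟩
    f 1 + sumTo n (f ∘ suc)  ≈⟨ +-congˡ (sumTo-shrink m≤n (λ x m<x x≤n → f≈0 (suc x) (s≤s m<x) (s≤s x≤n))) ⟩
    f 1 + sumTo m (f ∘ suc)  ≈⟨ sym (sumTo-suc m f) ⟩
    sumTo (suc m) f          ∎

  sumTo-single : ∀ {n t f} → 1 ≤ t → t ≤ n → (∀ x → 1 ≤ x → x ≤ n → x ≢ t → f x ≈ 0#) → sumTo n f ≈ f t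
  sumTo-single {suc n} {1} {f} _ _ f≈0 = begin
    sumTo (suc n) f          ≈⟨ sumTo-suc n f ⟩
    f 1 + sumTo n (f ∘ suc)  ≈⟨ +-congˡ (sumTo-vanish n (λ x 1≤x x≤n →
                                   f≈0 (suc x) (s≤s z≤n) (s≤s x≤n) (ℕₚ.>⇒≢ (s≤s 1≤x)))) ⟩
    f 1 + 0#                 ≈⟨ +-identityʳ _ ⟩
    f 1                      ∎
  sumTo-single {suc n} {suc (suc t)} {f} _ (s≤s t<n) f≈0 = begin
    sumTo (suc n) f          ≈⟨ sumTo-suc n f ⟩
    f 1 + sumTo n (f ∘ suc)  ≈⟨ +-cong (f≈0 1 (s≤s z≤n) (s≤s z≤n) (λ ())) (sumTo-single (s≤s z≤n) t<n f∘suc≈0) ⟩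
    0# + f (suc (suc t))     ≈⟨ +-identityˡ _ ⟩
    f (suc (suc t))          ∎
    where
    f∘suc≈0 : ∀ x → 1 ≤ x → x ≤ n → x ≢ suc t → f (suc x) ≈ 0#
    f∘suc≈0 x _ x≤n x≢ = f≈0 (suc x) (s≤s z≤n) (s≤s x≤n) (x≢ ∘ ℕₚ.suc-injective)

  sumTo-multiples : ∀ N {p} → 1 ≤ p → (f : ℕ → Carrier) →
                    sumTo (N *ℕ p) (λ e → [ p ∣? e ]· f e) ≈ sumTo N (λ l → f (l *ℕ p))
  sumTo-multiples zero    _   f = trans (sumTo-zero _) (sym (sumTo-zero _))
  sumTo-multiples (suc N) {p} 1≤p f = begin
    sumTo (p +ℕ N *ℕ p) F                          ≈⟨ sumTo-split p (N *ℕ p) F ⟩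
    sumTo p F + sumTo (N *ℕ p) (λ x → F (p +ℕ x))  ≈⟨ +-cong first-block later-blocks ⟩
    f (1 *ℕ p) + sumTo N (λ l → f (suc l *ℕ p))    ≈⟨ sym (sumTo-suc N _) ⟩
    sumTo (suc N) (λ l → f (l *ℕ p))               ∎
    where
    F : ℕ → Carrier
    F e = [ p ∣? e ]· f e
    first-block : sumTo p F ≈ f (1 *ℕ p)
    first-block = begin
      sumTo p F  ≈⟨ sumTo-single 1≤p ℕₚ.≤-refl (λ x 1≤x x≤p x≢p → []·-no (p ∣? x)
                      (λ p∣x → x≢p (ℕₚ.≤-antisym x≤p (∣⇒≤ {{>-nonZero 1≤x}} p∣x))) (f x)) ⟩
      F p        ≈⟨ []·-yes (p ∣? p) ∣-refl (f p) ⟩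
      f p        ≡⟨ ≡.cong f (≡.sym (ℕₚ.*-identityˡ p)) ⟩
      f (1 *ℕ p) ∎
    later-blocks : sumTo (N *ℕ p) (λ x → F (p +ℕ x)) ≈ sumTo N (λ l → f (suc l *ℕ p))
    later-blocks = trans
      (sumTo-cong (N *ℕ p) (λ x _ _ → []·-⇔ (λ p∣p+x → ∣m+n∣m⇒∣n p∣p+x ∣-refl) (∣m∣n⇒∣m+n ∣-refl)
                                              (p ∣? p +ℕ x) (p ∣? x) _))
      (sumTo-multiples N 1≤p (f ∘ (p +ℕ_)))

  sumTo-cofactor : ∀ {k c} → .{{NonZero k}} → 1 ≤ c → (V : ℕ → Carrier) →
                   sumTo k (λ x → [ x *ℕ c ≟ k ]· V x) ≈ [ c ∣? k ]· V (k ÷ c)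
  sumTo-cofactor {k} {suc c} _ V with suc c ∣? k
  ... | yes c∣k = trans
        (sumTo-single (÷-positive c∣k) (∣⇒≤ (÷-∣ c∣k))
          (λ x _ _ x≢ → []·-no (x *ℕ suc c ≟ k) (x≢ ∘ *-÷-cancel) (V x)))
        ([]·-yes (k ÷ suc c *ℕ suc c ≟ k) (÷-*-cancel c∣k) _)
  ... | no  c∤k = sumTo-vanish k (λ x _ _ → []·-no (x *ℕ suc c ≟ k) (λ x*c≡k → c∤k (divides x (≡.sym x*c≡k))) (V x))

  -- Sums over divisors

  divisorSum : ℕ → (ℕ → Carrier) → Carrier
  divisorSum n f = sumTo n (λ d → [ d ∣? n ]· f d)

  divisorSum-cong : ∀ n {f g : ℕ → Carrier} → (∀ d → d ∣ n → f d ≈ g d) → divisorSum n f ≈ divisorSum n g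
  divisorSum-cong n f≈g = sumTo-cong n (λ d _ _ → []·-cong (d ∣? n) (f≈g d))

  divisorSum-*ˡ : ∀ n a f → divisorSum n (λ d → a * f d) ≈ a * divisorSum n f
  divisorSum-*ˡ n a f = trans (sumTo-cong n (λ d _ _ → []·-*ˡ (d ∣? n) a (f d))) (sumTo-*ˡ n a _)

  divisorSum-*ʳ : ∀ n f a → divisorSum n (λ d → f d * a) ≈ divisorSum n f * a
  divisorSum-*ʳ n f a = begin
    divisorSum n (λ d → f d * a)  ≈⟨ divisorSum-cong n (λ d _ → *-comm (f d) a) ⟩
    divisorSum n (λ d → a * f d)  ≈⟨ divisorSum-*ˡ n a f ⟩
    a * divisorSum n f            ≈⟨ *-comm a _ ⟩
    divisorSum n f * a            ∎

  divisorSum-sumTo-comm : ∀ n m (F : ℕ → ℕ → Carrier) →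
                          divisorSum n (λ d → sumTo m (F d)) ≈ sumTo m (λ j → divisorSum n (λ d → F d j))
  divisorSum-sumTo-comm n m F = trans (sumTo-cong n (λ d _ _ → []·-sumTo (d ∣? n) m (F d))) (sumTo-comm n m _)

  divisorSum-extend : ∀ {n N f} → .{{NonZero n}} → n ≤ N → sumTo N (λ d → [ d ∣? n ]· f d) ≈ divisorSum n f
  divisorSum-extend {n} {f = f} n≤N = sumTo-shrink n≤N (λ d n<d _ → []·-no (d ∣? n) (>⇒∤ n<d) (f d))

  divisorSum-cofactor : ∀ {k} → .{{NonZero k}} → (H : ℕ → Carrier) → divisorSum k (λ d → H (k ÷ d)) ≈ divisorSum k H
  divisorSum-cofactor {k} H = begin
    sumTo k (λ d → [ d ∣? k ]· H (k ÷ d))               ≈⟨ sumTo-cong k (λ d 1≤d _ → sym (sumTo-cofactor 1≤d H)) ⟩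
    sumTo k (λ d → sumTo k (λ q → [ q *ℕ d ≟ k ]· H q))  ≈⟨ sumTo-comm k k _ ⟩
    sumTo k (λ q → sumTo k (λ d → [ q *ℕ d ≟ k ]· H q))  ≈⟨ sumTo-cong k (λ q _ _ → sumTo-cong k (λ d _ _ →
                                                             []·-⇔ (≡.trans (ℕₚ.*-comm d q)) (≡.trans (ℕₚ.*-comm q d))
                                                               (q *ℕ d ≟ k) (d *ℕ q ≟ k) (H q))) ⟩
    sumTo k (λ q → sumTo k (λ d → [ d *ℕ q ≟ k ]· H q))  ≈⟨ sumTo-cong k (λ q 1≤q _ → sumTo-cofactor 1≤q (λ _ → H q)) ⟩
    sumTo k (λ q → [ q ∣? k ]· H q)                      ∎

module _ where

  open import Data.Integer.Properties using (+-*-commutativeRing)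
  open InRing +-*-commutativeRing using (Σ)
  open Sums +-*-commutativeRing
  open ≡.≡-Reasoning

  +length≡Σ : ∀ (xs : List ℕ) → + length xs ≡ Σ xs (λ _ → + 1)
  +length≡Σ []       = ≡.refl
  +length≡Σ (x ∷ xs) = ≡.cong (_+ℤ_ (+ 1)) (+length≡Σ xs)

  ω-sum : ∀ n → + ω n ≡ sumTo n (λ r → [ prime? r ×-dec r ∣? n ]· + 1)
  ω-sum n = begin
    + ω n                                                     ≡⟨ +length≡Σ (filter P? (range1 n)) ⟩
    Σ (filter P? (range1 n)) (λ _ → + 1)                      ≡⟨ Σ-filter P? (range1 n) _ ⟩
    Σ (range1 n) (λ r → [ P? r ]· + 1)                        ≡⟨ Σ-range1 n _ ⟩
    sumTo n (λ r → [ P? r ]· + 1)                             ∎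
    where
    P? : ∀ r → Dec (Prime r × r ∣ n)
    P? r = prime? r ×-dec r ∣? n

  ω-prime-* : ∀ {p e} → Prime p → ¬ p ∣ e → .{{NonZero e}} → ω (p *ℕ e) ≡ suc (ω e)
  ω-prime-* {p} {e} p-prime p∤e = ℤₚ.+-injective (begin
    + ω pe                                                       ≡⟨ ω-sum pe ⟩
    sumTo pe (λ r → [ A? r ]· + 1)                               ≡⟨ sumTo-cong pe (λ r _ _ → split r) ⟩
    sumTo pe (λ r → [ B? r ]· + 1 +ℤ [ r ≟ p ]· + 1)             ≡⟨ sumTo-+ pe _ _ ⟩
    sumTo pe (λ r → [ B? r ]· + 1) +ℤ sumTo pe (λ r → [ r ≟ p ]· + 1)
                                                                 ≡⟨ ≡.cong₂ _+ℤ_ divisors-of-e only-p ⟩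
    + ω e +ℤ + 1                                                 ≡⟨ ℤₚ.+-comm (+ ω e) (+ 1) ⟩
    + suc (ω e)                                                  ∎)
    where
    instance
      p≢0 : NonZero p
      p≢0 = prime⇒nonZero p-prime
    pe : ℕ
    pe = p *ℕ e
    A? : ∀ r → Dec (Prime r × r ∣ pe)
    A? r = prime? r ×-dec r ∣? pe
    B? : ∀ r → Dec (Prime r × r ∣ e)
    B? r = prime? r ×-dec r ∣? e
    split : ∀ r → [ A? r ]· + 1 ≡ [ B? r ]· + 1 +ℤ [ r ≟ p ]· + 1
    split r = []·-⊎ to (λ { (r-prime , r∣e) → r-prime , ∣n⇒∣m*n p r∣e })
                       (λ { ≡.refl → p-prime , ∣m⇒∣m*n e ∣-refl })
                       (λ { (_ , p∣e) ≡.refl → p∤e p∣e })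
                       (A? r) (B? r) (r ≟ p) (+ 1)
      where
      to : Prime r × r ∣ pe → (Prime r × r ∣ e) ⊎ r ≡ p
      to (r-prime , r∣pe) with euclidsLemma p e r-prime r∣pe
      ... | inj₁ r∣p = inj₂ (prime∣prime r-prime p-prime r∣p)
      ... | inj₂ r∣e = inj₁ (r-prime , r∣e)
    divisors-of-e : sumTo pe (λ r → [ B? r ]· + 1) ≡ + ω e
    divisors-of-e = ≡.trans (sumTo-shrink (ℕₚ.m≤n*m e p)
                               (λ r e<r _ → []·-no (B? r) (λ (_ , r∣e) → >⇒∤ e<r r∣e) (+ 1)))
                            (≡.sym (ω-sum e))
    only-p : sumTo pe (λ r → [ r ≟ p ]· + 1) ≡ + 1
    only-p = ≡.trans (sumTo-single (>-nonZero⁻¹ p) (ℕₚ.m≤m*n p e) (λ r _ _ r≢p → []·-no (r ≟ p) r≢p (+ 1)))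
                     ([]·-yes (p ≟ p) ≡.refl (+ 1))

  μ-prime-* : ∀ {p e} → Prime p → ¬ p ∣ e → .{{NonZero e}} → μ (p *ℕ e) ≡ -ℤ μ e
  μ-prime-* {p} {e} p-prime p∤e with any? (λ q → (2 ≤? q) ×-dec ((q *ℕ q) ∣? e)) (range0 e)
  ... | yes some = let q , 2≤q , q²∣e = satisfied some in
    μ-squareful {{ℕₚ.m*n≢0 p e {{prime⇒nonZero p-prime}}}} (q , 2≤q , ∣n⇒∣m*n p q²∣e)
  ... | no none  = begin
    μ (p *ℕ e)           ≡⟨ μ-squarefree (squarefree-prime-* p-prime p∤e (none ∘ square-factor-below)) ⟩
    -1ℤ ^ℤ ω (p *ℕ e)    ≡⟨ ≡.cong (-1ℤ ^ℤ_) (ω-prime-* p-prime p∤e) ⟩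
    -1ℤ ^ℤ suc (ω e)     ≡⟨ ℤₚ.-1*i≡-i (-1ℤ ^ℤ ω e) ⟩
    -ℤ (-1ℤ ^ℤ ω e)      ∎

module RingLemmas {c ℓ : Level} (R : CommutativeRing c ℓ) where

  open CommutativeRing R hiding (zero)
  open InRing R
  open Sums R
  open import Algebra.Properties.Semiring.Sum semiring using (sum; sum-cong-≋)
  open import Algebra.Properties.Ring ring
    using (-0#≈0#; -‿involutive; -1*x≈-x; -‿distribʳ-*; x∙y⁻¹≈ε⇒x≈y; +-inverseˡ-unique)
  open import Algebra.Properties.CommutativeSemiring.Exp commutativeSemiring
    using (^-homo-*; ^-assocʳ; ^-congˡ; ^-distrib-*)
  open import Algebra.Properties.Semiring.Mult semiring using (×-assoc-*; ×-congʳ)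
  open import Algebra.Properties.CommutativeSemiring.Binomial commutativeSemiring
    using (binomialExpansion; theorem)
  open import Relation.Binary.Reasoning.Setoid setoid

  -- Möbius inversion

  μᴿ : ℕ → Carrier
  μᴿ n = fromℤ (μ n)

  fromℤ-neg : ∀ z → fromℤ (-ℤ z) ≈ - fromℤ z
  fromℤ-neg (+ zero)  = sym -0#≈0#
  fromℤ-neg (+ suc n) = refl
  fromℤ-neg -[1+ n ]  = sym (-‿involutive _)

  μᴿ-*-prime : ∀ {p l} → Prime p → 1 ≤ l → μᴿ (l *ℕ p) ≈ - ([ ¬? (p ∣? l) ]· μᴿ l)
  μᴿ-*-prime {p} {l} p-prime 1≤l with p ∣? l
  ... | yes p∣l = trans (reflexive (≡.cong fromℤ (μ-squareful {{lp≢0}} (p , p≥2 , *-monoˡ-∣ p p∣l)))) (sym -0#≈0#)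
    where
    lp≢0 : NonZero (l *ℕ p)
    lp≢0 = ℕₚ.m*n≢0 l p {{>-nonZero 1≤l}} {{prime⇒nonZero p-prime}}
    p≥2 : 2 ≤ p
    p≥2 = nonTrivial⇒n>1 p {{prime⇒nonTrivial p-prime}}
  ... | no  p∤l = trans (reflexive (≡.cong fromℤ μ[lp]≡-μ[l])) (fromℤ-neg (μ l))
    where
    μ[lp]≡-μ[l] : μ (l *ℕ p) ≡ -ℤ μ l
    μ[lp]≡-μ[l] = ≡.trans (≡.cong μ (ℕₚ.*-comm l p)) (μ-prime-* p-prime p∤l {{>-nonZero 1≤l}})

  μᴿ-divisorSum-multiple : ∀ {p N} → Prime p → .{{NonZero N}} → divisorSum (N *ℕ p) μᴿ ≈ 0#
  μᴿ-divisorSum-multiple {p} {N} p-prime = begin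
    sumTo n T                                                                ≈⟨ sumTo-cong n (λ e _ _ → []·-¬ (p ∣? e) (T e)) ⟩
    sumTo n (λ e → [ p ∣? e ]· T e + [ ¬? (p ∣? e) ]· T e)                   ≈⟨ sumTo-+ n _ _ ⟩
    sumTo n (λ e → [ p ∣? e ]· T e) + sumTo n (λ e → [ ¬? (p ∣? e) ]· T e)   ≈⟨ +-cong multiples-of-p prime-to-p ⟩
    - X + X                                                                  ≈⟨ -‿inverseˡ X ⟩
    0#                                                                       ∎
    where
    instance
      p≢0 : NonZero p
      p≢0 = prime⇒nonZero p-prime
    n : ℕ
    n = N *ℕ p
    T : ℕ → Carrier
    T e = [ e ∣? n ]· μᴿ e
    X : Carrier
    X = divisorSum N (λ e → [ ¬? (p ∣? e) ]· μᴿ e)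

    multiples-of-p : sumTo n (λ e → [ p ∣? e ]· T e) ≈ - X
    multiples-of-p = begin
      sumTo n (λ e → [ p ∣? e ]· T e)                          ≈⟨ sumTo-multiples N (>-nonZero⁻¹ p) T ⟩
      sumTo N (λ l → [ l *ℕ p ∣? n ]· μᴿ (l *ℕ p))             ≈⟨ sumTo-cong N (λ l 1≤l _ → term l 1≤l) ⟩
      sumTo N (λ l → - ([ l ∣? N ]· [ ¬? (p ∣? l) ]· μᴿ l))    ≈⟨ sumTo-neg N _ ⟩
      - X                                                      ∎
      where
      term : ∀ l → 1 ≤ l → [ l *ℕ p ∣? n ]· μᴿ (l *ℕ p) ≈ - ([ l ∣? N ]· [ ¬? (p ∣? l) ]· μᴿ l)
      term l 1≤l = begin
        [ l *ℕ p ∣? n ]· μᴿ (l *ℕ p)              ≈⟨ []·-⇔ (*-cancelʳ-∣ p) (*-monoˡ-∣ p) (l *ℕ p ∣? n) (l ∣? N) _ ⟩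
        [ l ∣? N ]· μᴿ (l *ℕ p)                   ≈⟨ []·-cong (l ∣? N) (λ _ → μᴿ-*-prime p-prime 1≤l) ⟩
        [ l ∣? N ]· (- ([ ¬? (p ∣? l) ]· μᴿ l))   ≈⟨ []·-neg (l ∣? N) _ ⟩
        - ([ l ∣? N ]· [ ¬? (p ∣? l) ]· μᴿ l)     ∎

    prime-to-p : sumTo n (λ e → [ ¬? (p ∣? e) ]· T e) ≈ X
    prime-to-p = begin
      sumTo n (λ e → [ ¬? (p ∣? e) ]· [ e ∣? n ]· μᴿ e)   ≈⟨ sumTo-cong n (λ e _ _ → swap e) ⟩
      sumTo n (λ e → [ e ∣? N ]· [ ¬? (p ∣? e) ]· μᴿ e)   ≈⟨ divisorSum-extend (ℕₚ.m≤m*n N p) ⟩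
      X                                                  ∎
      where
      swap : ∀ e → [ ¬? (p ∣? e) ]· [ e ∣? n ]· μᴿ e ≈ [ e ∣? N ]· [ ¬? (p ∣? e) ]· μᴿ e
      swap e = begin
        [ ¬? (p ∣? e) ]· [ e ∣? n ]· μᴿ e     ≈⟨ []·-[]· (¬? (p ∣? e)) (e ∣? n) _ ⟩
        [ ¬? (p ∣? e) ×-dec e ∣? n ]· μᴿ e    ≈⟨ []·-⇔ to from (¬? (p ∣? e) ×-dec e ∣? n)
                                                             (e ∣? N ×-dec ¬? (p ∣? e)) _ ⟩
        [ e ∣? N ×-dec ¬? (p ∣? e) ]· μᴿ e    ≈⟨ sym ([]·-[]· (e ∣? N) (¬? (p ∣? e)) _) ⟩
        [ e ∣? N ]· [ ¬? (p ∣? e) ]· μᴿ e     ∎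
        where
        to : ¬ p ∣ e × e ∣ n → e ∣ N × ¬ p ∣ e
        to (p∤e , e∣Np) = coprime-divisor (prime∤⇒coprime p-prime p∤e) (≡.subst (e ∣_) (ℕₚ.*-comm N p) e∣Np) , p∤e
        from : e ∣ N × ¬ p ∣ e → ¬ p ∣ e × e ∣ n
        from (e∣N , p∤e) = p∤e , ∣m⇒∣m*n p e∣N

  μᴿ-divisorSum : ∀ n → .{{NonZero n}} → divisorSum n μᴿ ≈ [ n ≟ 1 ]· 1#
  μᴿ-divisorSum 1 = trans (sumTo-1 _) (+-identityʳ 1#)
  μᴿ-divisorSum n@(suc (suc _)) with prime-factor n (s≤s (s≤s z≤n))
  ... | p , p-prime , divides (suc N) n≡N′p =
    trans (reflexive (≡.cong (λ m → divisorSum m μᴿ) n≡N′p)) (μᴿ-divisorSum-multiple {N = suc N} p-prime)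

  μᴿ-divisorSum-coprime : ∀ {k m} → .{{NonZero k}} → .{{NonZero m}} →
                    divisorSum k (λ q → [ q ∣? m ]· μᴿ q) ≈ [ coprime? m k ]· 1#
  μᴿ-divisorSum-coprime {k} {m} = begin
    sumTo k (λ q → [ q ∣? k ]· [ q ∣? m ]· μᴿ q)   ≈⟨ sumTo-cong k (λ q _ _ → common-divisor q) ⟩
    sumTo k (λ q → [ q ∣? g ]· μᴿ q)               ≈⟨ divisorSum-extend (∣⇒≤ (gcd[m,n]∣n m k)) ⟩
    divisorSum g μᴿ                                ≈⟨ μᴿ-divisorSum g ⟩
    [ g ≟ 1 ]· 1#                                  ≈⟨ []·-⇔ gcd≡1⇒coprime coprime⇒gcd≡1 (g ≟ 1) (coprime? m k) 1# ⟩
    [ coprime? m k ]· 1#                           ∎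
    where
    g : ℕ
    g = gcd m k
    instance
      g≢0 : NonZero g
      g≢0 = ≢-nonZero (gcd[m,n]≢0 m k (inj₁ (≢-nonZero⁻¹ m)))
    common-divisor : ∀ q → [ q ∣? k ]· [ q ∣? m ]· μᴿ q ≈ [ q ∣? g ]· μᴿ q
    common-divisor q = trans ([]·-[]· (q ∣? k) (q ∣? m) _)
      ([]·-⇔ (λ (q∣k , q∣m) → gcd-greatest q∣m q∣k)
             (λ q∣g → ∣-trans q∣g (gcd[m,n]∣n m k) , ∣-trans q∣g (gcd[m,n]∣m m k))
             (q ∣? k ×-dec q ∣? m) (q ∣? g) _)

  möbius-coprime-sum : ∀ {k} → .{{NonZero k}} → (G : ℕ → Carrier) →
    divisorSum k (λ d → μᴿ (k ÷ d) * sumTo d (λ l → G (l *ℕ (k ÷ d)))) ≈ sumTo k (λ m → [ coprime? m k ]· G m)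
  möbius-coprime-sum {k} G = begin
    divisorSum k (λ d → μᴿ (k ÷ d) * sumTo d (λ l → G (l *ℕ (k ÷ d))))
      ≈⟨ divisorSum-cong k (λ d d∣k → *-congˡ (multiples-of-cofactor d∣k)) ⟩
    divisorSum k (λ d → μᴿ (k ÷ d) * sumTo k (λ m → [ k ÷ d ∣? m ]· G m))
      ≈⟨ divisorSum-cong k (λ d _ → trans (sym (sumTo-*ˡ k _ _)) (sumTo-cong k (λ m _ _ → pull-μᴿ (k ÷ d) m))) ⟩
    divisorSum k (λ d → sumTo k (λ m → [ k ÷ d ∣? m ]· μᴿ (k ÷ d) * G m))
      ≈⟨ divisorSum-sumTo-comm k k _ ⟩
    sumTo k (λ m → divisorSum k (λ d → [ k ÷ d ∣? m ]· μᴿ (k ÷ d) * G m))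
      ≈⟨ sumTo-cong k (λ m 1≤m _ → trans (divisorSum-*ʳ k _ (G m)) (*-congʳ (coefficient m 1≤m))) ⟩
    sumTo k (λ m → [ coprime? m k ]· 1# * G m)
      ≈⟨ sumTo-cong k (λ m _ _ → trans (sym ([]·-*ʳ (coprime? m k) 1# (G m)))
                                        ([]·-cong (coprime? m k) (λ _ → *-identityˡ (G m)))) ⟩
    sumTo k (λ m → [ coprime? m k ]· G m)
      ∎
    where
    multiples-of-cofactor : ∀ {d} → d ∣ k → sumTo d (λ l → G (l *ℕ (k ÷ d))) ≈ sumTo k (λ m → [ k ÷ d ∣? m ]· G m)
    multiples-of-cofactor {d} d∣k = begin
      sumTo d (λ l → G (l *ℕ (k ÷ d)))                  ≈⟨ sym (sumTo-multiples d (÷-positive d∣k) G) ⟩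
      sumTo (d *ℕ (k ÷ d)) (λ m → [ k ÷ d ∣? m ]· G m)  ≡⟨ ≡.cong (λ n → sumTo n (λ m → [ k ÷ d ∣? m ]· G m))
                                                               (≡.trans (ℕₚ.*-comm d (k ÷ d)) (÷-*-cancel d∣k)) ⟩
      sumTo k (λ m → [ k ÷ d ∣? m ]· G m)               ∎
    pull-μᴿ : ∀ q m → μᴿ q * [ q ∣? m ]· G m ≈ [ q ∣? m ]· μᴿ q * G m
    pull-μᴿ q m = trans (sym ([]·-*ˡ (q ∣? m) (μᴿ q) (G m))) ([]·-*ʳ (q ∣? m) (μᴿ q) (G m))
    coefficient : ∀ m → 1 ≤ m → divisorSum k (λ d → [ k ÷ d ∣? m ]· μᴿ (k ÷ d)) ≈ [ coprime? m k ]· 1#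
    coefficient m 1≤m = trans (divisorSum-cofactor (λ q → [ q ∣? m ]· μᴿ q)) μᴿ-divisorSum-coprime
      where
      instance
        m≢0 : NonZero m
        m≢0 = >-nonZero 1≤m

  mutual
    Σdiv≈divisorSum : ∀ k f → Σdiv k f ≈ divisorSum k (λ d → f d (k ÷ d))
    Σdiv≈divisorSum k f =
      trans (Σ-cong (upTo k) (Σdiv-summand k f)) (reflexive (Σ-upTo k (λ d → [ d ∣? k ]· f d (k ÷ d))))

    -- The left-hand side is the summand local to Σdiv, which cannot be named; it is solved from the use above.
    Σdiv-summand : ∀ k f e → _ ≈ [ suc e ∣? k ]· f (suc e) (k ÷ suc e)
    Σdiv-summand k f e with suc e ∣? k
    ... | yes _ = refl
    ... | no  _ = refl

  -- The binomial theorem and Ramanujan sums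

  ×≈×1* : ∀ n x → n ·ℕ x ≈ (n ·ℕ 1#) * x
  ×≈×1* n x = trans (×-congʳ n (sym (*-identityˡ x))) (sym (×-assoc-* n 1# x))

  1^n≈1 : ∀ n → 1# ^ n ≈ 1#
  1^n≈1 zero    = refl
  1^n≈1 (suc n) = trans (*-identityˡ _) (1^n≈1 n)

  binomial : ∀ n x → sum {suc n} (λ j → (n C toℕ j) ·ℕ 1# * x ^ toℕ j) ≈ (1# + x) ^ n
  binomial n x = begin
    sum {suc n} (λ j → (n C toℕ j) ·ℕ 1# * x ^ toℕ j)  ≈⟨ sum-cong-≋ {suc n} (λ j → term (toℕ j)) ⟩
    binomialExpansion x 1# n                    ≈⟨ sym (theorem n x 1#) ⟩
    (x + 1#) ^ n                                ≈⟨ ^-congˡ n (+-comm x 1#) ⟩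
    (1# + x) ^ n                                ∎
    where
    term : ∀ j → (n C j) ·ℕ 1# * x ^ j ≈ (n C j) ·ℕ (x ^ j * 1# ^ (n ∸ j))
    term j = trans (sym (×≈×1* (n C j) _))
                   (×-congʳ (n C j) (trans (sym (*-identityʳ _)) (*-congˡ (sym (1^n≈1 (n ∸ j))))))

  ramanujan≈sumTo : ∀ ζ k j → ramanujan ζ k j ≈ sumTo k (λ m → [ coprime? m k ]· ζ ^ (2 *ℕ m *ℕ j))
  ramanujan≈sumTo ζ k j = trans (Σ-filter (λ m → coprime? m k) (range1 k) _) (reflexive (Σ-range1 k _))

  binomial-ramanujan : ∀ ζ k → Σ (range0 k) (λ j → (k C j) ·ℕ ramanujan ζ k j)
                               ≈ sumTo k (λ m → [ coprime? m k ]· (1# + ζ ^ (2 *ℕ m)) ^ k)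
  binomial-ramanujan ζ k = begin
    Σ (range0 k) (λ j → (k C j) ·ℕ ramanujan ζ k j)
      ≡⟨ Σ-applyUpTo id (suc k) _ ⟩
    sum {suc k} (λ j → (k C toℕ j) ·ℕ ramanujan ζ k (toℕ j))
      ≈⟨ sum-cong-≋ {suc k} (λ j → trans (×≈×1* (k C toℕ j) _) (*-congˡ (ramanujan≈sumTo ζ k (toℕ j)))) ⟩
    sum {suc k} (λ j → binom j * sumTo k (λ m → [ coprime? m k ]· ζ ^ (2 *ℕ m *ℕ toℕ j)))
      ≈⟨ sum-cong-≋ {suc k} (λ j → sym (sumTo-*ˡ k (binom j) (λ m → [ coprime? m k ]· ζ ^ (2 *ℕ m *ℕ toℕ j)))) ⟩
    sum {suc k} (λ j → sumTo k (λ m → binom j * [ coprime? m k ]· ζ ^ (2 *ℕ m *ℕ toℕ j)))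
      ≈⟨ sum-sumTo-comm (suc k) k (λ j m → binom j * [ coprime? m k ]· ζ ^ (2 *ℕ m *ℕ toℕ j)) ⟩
    sumTo k (λ m → sum {suc k} (λ j → binom j * [ coprime? m k ]· ζ ^ (2 *ℕ m *ℕ toℕ j)))
      ≈⟨ sumTo-cong k (λ m _ _ → coprime-term m) ⟩
    sumTo k (λ m → [ coprime? m k ]· (1# + ζ ^ (2 *ℕ m)) ^ k)
      ∎
    where
    binom : Fin (suc k) → Carrier
    binom j = (k C toℕ j) ·ℕ 1#
    coprime-term : ∀ m → sum {suc k} (λ j → binom j * [ coprime? m k ]· ζ ^ (2 *ℕ m *ℕ toℕ j))
                         ≈ [ coprime? m k ]· (1# + ζ ^ (2 *ℕ m)) ^ k
    coprime-term m = begin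
      sum {suc k} (λ j → binom j * [ D ]· ζ ^ (2 *ℕ m *ℕ toℕ j))
        ≈⟨ sum-cong-≋ {suc k} (λ j → sym ([]·-*ˡ D (binom j) (ζ ^ (2 *ℕ m *ℕ toℕ j)))) ⟩
      sum {suc k} (λ j → [ D ]· (binom j * ζ ^ (2 *ℕ m *ℕ toℕ j)))
        ≈⟨ sym ([]·-sum D (suc k) (λ j → binom j * ζ ^ (2 *ℕ m *ℕ toℕ j))) ⟩
      [ D ]· sum {suc k} (λ j → binom j * ζ ^ (2 *ℕ m *ℕ toℕ j))
        ≈⟨ []·-cong D (λ _ → sum-cong-≋ {suc k} (λ j → *-congˡ {binom j} (sym (^-assocʳ ζ (2 *ℕ m) (toℕ j))))) ⟩
      [ D ]· sum {suc k} (λ j → binom j * (ζ ^ (2 *ℕ m)) ^ toℕ j)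
        ≈⟨ []·-cong D (λ _ → binomial k (ζ ^ (2 *ℕ m))) ⟩
      [ D ]· (1# + ζ ^ (2 *ℕ m)) ^ k
        ∎
      where
      D : Dec (Coprime m k)
      D = coprime? m k

  -- Roots of unity

  x*x≈1⇒x≈±1 : (∀ x y → x * y ≈ 0# → x ≈ 0# ⊎ y ≈ 0#) → ∀ x → x * x ≈ 1# → x ≈ - 1# ⊎ x ≈ 1#
  x*x≈1⇒x≈±1 no-zero-divisors x x²≈1 =
    Sum.map (+-inverseˡ-unique x 1#) (x∙y⁻¹≈ε⇒x≈y x 1#) (no-zero-divisors (x + 1#) (x - 1#) product≈0)
    where
    product≈0 : (x + 1#) * (x - 1#) ≈ 0#
    product≈0 = begin
      (x + 1#) * (x - 1#)                   ≈⟨ distribˡ (x + 1#) x (- 1#) ⟩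
      (x + 1#) * x + (x + 1#) * - 1#        ≈⟨ +-cong (distribʳ x x 1#) (sym (-‿distribʳ-* (x + 1#) 1#)) ⟩
      (x * x + 1# * x) - (x + 1#) * 1#      ≈⟨ +-cong (+-cong x²≈1 (*-identityˡ x)) (-‿cong (*-identityʳ _)) ⟩
      (1# + x) - (x + 1#)                   ≈⟨ +-congʳ (+-comm 1# x) ⟩
      (x + 1#) - (x + 1#)                   ≈⟨ -‿inverseʳ _ ⟩
      0#                                    ∎

  primitive-root^k≈-1 : (∀ x y → x * y ≈ 0# → x ≈ 0# ⊎ y ≈ 0#) → ∀ {ζ k} → 1 ≤ k → ζ ^ (2 *ℕ k) ≈ 1# →
                        (∀ m → 0 < m → m < 2 *ℕ k → ¬ (ζ ^ m ≈ 1#)) → ζ ^ k ≈ - 1#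
  primitive-root^k≈-1 no-zero-divisors {ζ} {k} 1≤k ζ²ᵏ≈1 ζ-primitive =
    [ id , (λ ζᵏ≈1 → ⊥-elim (ζ-primitive k 1≤k k<2k ζᵏ≈1)) ]′ (x*x≈1⇒x≈±1 no-zero-divisors (ζ ^ k) ζᵏζᵏ≈1)
    where
    k<2k : k < 2 *ℕ k
    k<2k = ℕₚ.m<m+n k (ℕₚ.≤-trans 1≤k (ℕₚ.m≤m+n k 0))
    ζᵏζᵏ≈1 : ζ ^ k * ζ ^ k ≈ 1#
    ζᵏζᵏ≈1 = begin
      ζ ^ k * ζ ^ k  ≈⟨ sym (^-homo-* ζ k k) ⟩
      ζ ^ (k +ℕ k)   ≡⟨ ≡.cong (λ n → ζ ^ (k +ℕ n)) (≡.sym (ℕₚ.+-identityʳ k)) ⟩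
      ζ ^ (2 *ℕ k)   ≈⟨ ζ²ᵏ≈1 ⟩
      1#             ∎

  module _ (ζ : Carrier) (k : ℕ) (ζᵏ≈-1 : ζ ^ k ≈ - 1#) where

    ζ-cosine-power : ∀ h b → b ≤ 2 *ℕ k →
                     (- 1#) ^ b * ((ζ ^ b + ζ ^ (2 *ℕ k ∸ b)) * h) ^ k ≈ h ^ k * (1# + ζ ^ (2 *ℕ b)) ^ k
    ζ-cosine-power h b b≤2k = begin
      (- 1#) ^ b * (u * h) ^ k           ≈⟨ *-cong (^-congˡ b (sym ζᵏ≈-1)) (^-distrib-* u h k) ⟩
      (ζ ^ k) ^ b * (u ^ k * h ^ k)      ≈⟨ *-congʳ (ζᵏᵇ≈ζᵇᵏ) ⟩
      (ζ ^ b) ^ k * (u ^ k * h ^ k)      ≈⟨ sym (*-assoc _ _ _) ⟩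
      ((ζ ^ b) ^ k * u ^ k) * h ^ k      ≈⟨ *-congʳ (sym (^-distrib-* (ζ ^ b) u k)) ⟩
      (ζ ^ b * u) ^ k * h ^ k            ≈⟨ *-congʳ (^-congˡ k ζᵇu≈1+ζ²ᵇ) ⟩
      (1# + ζ ^ (2 *ℕ b)) ^ k * h ^ k    ≈⟨ *-comm _ _ ⟩
      h ^ k * (1# + ζ ^ (2 *ℕ b)) ^ k    ∎
      where
      u : Carrier
      u = ζ ^ b + ζ ^ (2 *ℕ k ∸ b)
      ζᵏᵇ≈ζᵇᵏ : (ζ ^ k) ^ b ≈ (ζ ^ b) ^ k
      ζᵏᵇ≈ζᵇᵏ = begin
        (ζ ^ k) ^ b    ≈⟨ ^-assocʳ ζ k b ⟩
        ζ ^ (k *ℕ b)   ≡⟨ ≡.cong (ζ ^_) (ℕₚ.*-comm k b) ⟩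
        ζ ^ (b *ℕ k)   ≈⟨ sym (^-assocʳ ζ b k) ⟩
        (ζ ^ b) ^ k    ∎
      ζ²ᵏ≈1 : ζ ^ (2 *ℕ k) ≈ 1#
      ζ²ᵏ≈1 = begin
        ζ ^ (2 *ℕ k)     ≡⟨ ≡.cong (λ n → ζ ^ (k +ℕ n)) (ℕₚ.+-identityʳ k) ⟩
        ζ ^ (k +ℕ k)     ≈⟨ ^-homo-* ζ k k ⟩
        ζ ^ k * ζ ^ k    ≈⟨ *-cong ζᵏ≈-1 ζᵏ≈-1 ⟩
        - 1# * - 1#      ≈⟨ -1*x≈-x (- 1#) ⟩
        - - 1#           ≈⟨ -‿involutive 1# ⟩
        1#               ∎
      ζᵇu≈1+ζ²ᵇ : ζ ^ b * u ≈ 1# + ζ ^ (2 *ℕ b)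
      ζᵇu≈1+ζ²ᵇ = begin
        ζ ^ b * (ζ ^ b + ζ ^ (2 *ℕ k ∸ b))              ≈⟨ distribˡ _ _ _ ⟩
        ζ ^ b * ζ ^ b + ζ ^ b * ζ ^ (2 *ℕ k ∸ b)        ≈⟨ +-cong (sym (^-homo-* ζ b b)) (sym (^-homo-* ζ b _)) ⟩
        ζ ^ (b +ℕ b) + ζ ^ (b +ℕ (2 *ℕ k ∸ b))          ≡⟨ ≡.cong₂ (λ m n → ζ ^ m + ζ ^ n)
                                                              (≡.cong (b +ℕ_) (≡.sym (ℕₚ.+-identityʳ b)))
                                                              (ℕₚ.m+[n∸m]≡n b≤2k) ⟩
        ζ ^ (2 *ℕ b) + ζ ^ (2 *ℕ k)                     ≈⟨ +-congˡ ζ²ᵏ≈1 ⟩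
        ζ ^ (2 *ℕ b) + 1#                               ≈⟨ +-comm _ _ ⟩
        1# + ζ ^ (2 *ℕ b)                               ∎

    ζ-cosine-power-sum : ∀ h d q → d *ℕ q ≤ 2 *ℕ k →
      Σ (range1 d) (λ l → ((- 1#) ^ (l *ℕ q)) * (((ζ ^ (l *ℕ q) + ζ ^ (2 *ℕ k ∸ l *ℕ q)) * h) ^ k))
        ≈ h ^ k * sumTo d (λ l → (1# + ζ ^ (2 *ℕ (l *ℕ q))) ^ k)
    ζ-cosine-power-sum h d q dq≤2k = begin
      Σ (range1 d) (λ l → ((- 1#) ^ (l *ℕ q)) * (((ζ ^ (l *ℕ q) + ζ ^ (2 *ℕ k ∸ l *ℕ q)) * h) ^ k))
        ≡⟨ Σ-range1 d _ ⟩
      sumTo d (λ l → ((- 1#) ^ (l *ℕ q)) * (((ζ ^ (l *ℕ q) + ζ ^ (2 *ℕ k ∸ l *ℕ q)) * h) ^ k))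
        ≈⟨ sumTo-cong d (λ l _ l≤d → ζ-cosine-power h (l *ℕ q) (ℕₚ.≤-trans (ℕₚ.*-monoˡ-≤ q l≤d) dq≤2k)) ⟩
      sumTo d (λ l → h ^ k * (1# + ζ ^ (2 *ℕ (l *ℕ q))) ^ k)
        ≈⟨ sumTo-*ˡ d (h ^ k) _ ⟩
      h ^ k * sumTo d (λ l → (1# + ζ ^ (2 *ℕ (l *ℕ q))) ^ k)
        ∎

proposition5 : {c ℓ : Level} (R : CommutativeRing c ℓ) →
    let open CommutativeRing R
        open InRing R
    in (∀ x y → x * y ≈ 0# → (x ≈ 0#) ⊎ (y ≈ 0#)) →
       (∀ n → n ·ℕ 1# ≈ 0# → n ≡ 0) →
       (half : Carrier) → (1# + 1#) * half ≈ 1# →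
       (k : ℕ) → 1 ≤ k →
       (ζ : Carrier) → ζ ^ (2 *ℕ k) ≈ 1# →
       (∀ m → 0 < m → m < 2 *ℕ k → ¬ (ζ ^ m ≈ 1#)) →
       (half ^ k) * Σ (range0 k) (λ j → (k C j) ·ℕ ramanujan ζ k j)
         ≈ Σdiv k (λ d q → fromℤ (μ q) *
             Σ (range1 d) (λ l → ((- 1#) ^ (l *ℕ q)) *
               (((ζ ^ (l *ℕ q) + ζ ^ (2 *ℕ k ∸ l *ℕ q)) * half) ^ k)))
proposition5 R no-zero-divisors _ half _ k 1≤k ζ ζ²ᵏ≈1 ζ-primitive = begin
  half ^ k * Σ (range0 k) (λ j → (k C j) ·ℕ ramanujan ζ k j)   ≈⟨ *-congˡ (binomial-ramanujan ζ k) ⟩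
  half ^ k * sumTo k (λ m → [ coprime? m k ]· G m)              ≈⟨ *-congˡ (sym (möbius-coprime-sum G)) ⟩
  half ^ k * divisorSum k (λ d → μᴿ (k ÷ d) * sumTo d (λ l → G (l *ℕ (k ÷ d))))
                                                                ≈⟨ sym (divisorSum-*ˡ k (half ^ k) _) ⟩
  divisorSum k (λ d → half ^ k * (μᴿ (k ÷ d) * sumTo d (λ l → G (l *ℕ (k ÷ d)))))
                                                                ≈⟨ divisorSum-cong k summand ⟩
  divisorSum k (λ d → F d (k ÷ d))                              ≈⟨ sym (Σdiv≈divisorSum k F) ⟩
  Σdiv k F                                                      ∎
  where
  open CommutativeRing R hiding (zero)
  open InRing R
  open Sums R
  open RingLemmas R
  open import Algebra.Properties.CommutativeSemigroup *-commutativeSemigroup using (x∙yz≈y∙xz)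
  open import Relation.Binary.Reasoning.Setoid setoid
  instance
    k≢0 : NonZero k
    k≢0 = >-nonZero 1≤k
  G : ℕ → Carrier
  G m = (1# + ζ ^ (2 *ℕ m)) ^ k
  F : ℕ → ℕ → Carrier
  F d q = fromℤ (μ q) * Σ (range1 d) (λ l → ((- 1#) ^ (l *ℕ q)) * (((ζ ^ (l *ℕ q) + ζ ^ (2 *ℕ k ∸ l *ℕ q)) * half) ^ k))
  ζᵏ≈-1 : ζ ^ k ≈ - 1#
  ζᵏ≈-1 = primitive-root^k≈-1 no-zero-divisors 1≤k ζ²ᵏ≈1 ζ-primitive
  summand : ∀ d → d ∣ k → half ^ k * (μᴿ (k ÷ d) * sumTo d (λ l → G (l *ℕ (k ÷ d)))) ≈ F d (k ÷ d)
  summand d d∣k = trans (x∙yz≈y∙xz _ _ _) (*-congˡ (sym (ζ-cosine-power-sum ζ k ζᵏ≈-1 half d (k ÷ d) d[k÷d]≤2k)))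
    where
    d[k÷d]≤2k : d *ℕ (k ÷ d) ≤ 2 *ℕ k
    d[k÷d]≤2k = ℕₚ.≤-trans (ℕₚ.≤-reflexive (≡.trans (ℕₚ.*-comm d (k ÷ d)) (÷-*-cancel d∣k))) (ℕₚ.m≤n*m k 2)
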